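{- Let $D=(G,\mathcal{O},w)$ be a weighted oriented graph and $e$ an edge of $G$. The following are equivalent: (1) $|\mathcal{C}\cap e|=1$ for every strong vertex cover $\mathcal{C}$ of $D$; (2) $e$ has property (P), and $N_D(b)\subseteq N_D^{+}(a)$ whenever $e=\{b,b'\}$, $(a,b')\in E(D)$ and $a\in V^{+}$.
   Context: A weighted oriented graph is a triple $D=(G,\mathcal{O},w)$ with $G$ a finite simple graph, $\mathcal{O}$ an orientation of its edges, $w:V(G)\to\mathbb{N}$; $E(D)$ is the set of oriented edges. $V^{+}=\{x\mid w(x)>1\}$. $N_D^{+}(x)=\{y\mid(x,y)\in E(D)\}$, $N_D^{ - }(x)=\{y\mid(y,x)\in E(D)\}$, $N_D(x)=N_D^+(x)\cup N_D^-(x)$. Standing convention: every source (vertex with $N_D^-(x)=\emptyset$) has weight $1$. A vertex cover of $D$ is a set of vertices meeting every edge. For a vertex cover $\mathcal{C}$: $L_1(\mathcal{C})=\{x\in\mathcal{C}\mid N_D^+(x)\setminus\mathcal{C}\ne\emptyset\}$, $L_2(\mathcal{C})=\{x\in\mathcal{C}\setminus L_1(\mathcal{C})\mid N_D^-(x)\setminus\mathcal{C}\ne\emptyset\}$, $L_3(\mathcal{C})=\mathcal{C}\setminus(L_1(\mathcal{C})\cup L_2(\mathcal{C}))$. $\mathcal{C}$ is strong if for every $x\in L_3(\mathcal{C})$ there is $(y,x)\in E(D)$ with $y\in(\mathcal{C}\setminus L_1(\mathcal{C}))\cap V^+$. An edge $e=\{b,b'\}$ has property (P) if for all edges $\{a,b\},\{a',b'\}\in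 E(G)$ we have $\{a,a'\}\in E(G)$. -}

module Defs where

open import Data.Nat using (ℕ; _<_)
open import Data.Fin using (Fin)
open import Data.Bool using (Bool; T)
open import Data.Product using (Σ; _×_; ∃; ∃-syntax)
open import Data.Sum using (_⊎_)
open import Data.Empty using (⊥)
open import Relation.Nullary using (¬_)
open import Relation.Binary.PropositionalEquality using (_≡_)
open import Data.Fin.Subset using (Subset; _∈_; _∉_) public

-- The underlying graph G is simple (no loops) and every edge of G carries
-- exactly one orientation, so arcs are irreflexive and antisymmetric.
record WOG (n : ℕ) : Set where
  field
    arc      : Fin n → Fin n → Bool
    w        : Fin n → ℕ
    no-loop  : ∀ x → ¬ T (arc x x)
    oriented : ∀ x y → T (arc x y) → ¬ T (arc y x)
    -- standing convention: every source has weight 1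
    source-w : ∀ x → (∀ y → ¬ T (arc y x)) → w x ≡ 1

module _ {n : ℕ} (D : WOG n) where
  open WOG D

  Arc : Fin n → Fin n → Set
  Arc x y = T (arc x y)

  Adj : Fin n → Fin n → Set
  Adj x y = Arc x y ⊎ Arc y x

  InV⁺ : Fin n → Set
  InV⁺ x = 1 < w x

  IsVertexCover : Subset n → Set
  IsVertexCover C = ∀ x y → Arc x y → x ∈ C ⊎ y ∈ C

  InL₁ : Subset n → Fin n → Set
  InL₁ C x = x ∈ C × ∃[ y ] (Arc x y × y ∉ C)

  InL₂ : Subset n → Fin n → Set
  InL₂ C x = x ∈ C × ¬ InL₁ C x × ∃[ y ] (Arc y x × y ∉ C)

  InL₃ : Subset n → Fin n → Set
  InL₃ C x = x ∈ C × ¬ InL₁ C x × ¬ InL₂ C x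

  IsStrongVertexCover : Subset n → Set
  IsStrongVertexCover C =
    IsVertexCover C ×
    (∀ x → InL₃ C x → ∃[ y ] (Arc y x × y ∈ C × ¬ InL₁ C y × InV⁺ y))

  -- |C ∩ {b , b'}| = 1  (for b ≢ b')
  MeetsOnce : Subset n → Fin n → Fin n → Set
  MeetsOnce C b b' = (b ∈ C × b' ∉ C) ⊎ (b ∉ C × b' ∈ C)

  PropertyP : Fin n → Fin n → Set
  PropertyP b b' = ∀ a a' → Adj a b → Adj a' b' → Adj a a'

  NbhdCond : Fin n → Fin n → Set
  NbhdCond b b' = ∀ a → Arc a b' → InV⁺ a → ∀ x → Adj b x → Arc a x

-- Forward direction: complements of maximal independent sets are strong vertex
-- covers, since every vertex outside such a set I has a neighbour in I and
-- so lies in L₁ ∪ L₂.  If (P) fails for a ~ b, a' ~ b', extend {a, a'} to a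
-- maximal independent set; its complement contains both b and b'.  If the
-- neighbourhood condition fails for a → b', x ~ b and a ↛ x, then x → a and
-- we extend {x} to a maximal independent set avoiding N⁺(a): its complement
-- is still strong, the new L₃-vertices being supported by a ∈ V⁺, and it
-- again contains b and b'.
-- Backward direction: if a strong cover C contains b and b', then one of
-- them, say b', has all its neighbours in C, so b' ∈ L₃ is supported by some
-- a ∈ V⁺ with N⁺(a) ⊆ C.  Then N(b) ⊆ N⁺(a) ⊆ C, so b ∈ L₃ is supported by
-- some a' ∈ V⁺, and the neighbourhood condition forces both a → a' and
-- a' → a.  Hence b and b' both have neighbours outside C, and (P) makes
-- those neighbours adjacent, an uncovered edge.
module Submission where

open import Defs
open import Data.Nat using (ℕ)
open import Data.Fin using (Fin)
open import Data.Fin.Properties using (any?)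
open import Data.Fin.Subset using (_⊆_; _∪_; ⁅_⁆; ∁)
open import Data.Fin.Subset.Properties
  using ( _∈?_; x∈⁅x⁆; x∈⁅y⁆⇒x≡y; p⊆p∪q; q⊆p∪q; x∈p∪q⁻
        ; x∉p⇒x∈∁p; x∈∁p⇒x∉p; x∉∁p⇒x∈p)
open import Data.Empty using (⊥; ⊥-elim)
open import Data.Product using (_×_; _,_; ∃-syntax)
open import Data.Sum using (_⊎_; inj₁; inj₂; [_,_])
open import Data.List using (List; []; _∷_; allFin)
open import Data.List.Relation.Unary.All as All using (All; []; _∷_)
open import Data.List.Membership.Propositional.Properties using (∈-allFin)
open import Function using (_∘_; id)
open import Function.Bundles using (_⇔_; mk⇔)
open import Relation.Nullary using (¬_; Dec; yes; no; contradiction)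
open import Relation.Nullary.Decidable using (_×-dec_; _⊎-dec_; ¬?; T?)
open import Relation.Unary using (Decidable)

module _ {n : ℕ} (D : WOG n) where
  open WOG D

  Adj-sym : ∀ {x y} → Adj D x y → Adj D y x
  Adj-sym (inj₁ xy) = inj₂ xy
  Adj-sym (inj₂ yx) = inj₁ yx

  Adj? : ∀ x y → Dec (Adj D x y)
  Adj? x y = T? (arc x y) ⊎-dec T? (arc y x)

  IsVertexCover-Adj : ∀ {C x y} → IsVertexCover D C → Adj D x y → x ∈ C ⊎ y ∈ C
  IsVertexCover-Adj cover (inj₁ xy) = cover _ _ xy
  IsVertexCover-Adj cover (inj₂ yx) = [ inj₂ , inj₁ ] (cover _ _ yx)

  MeetsOnce-sym : ∀ {C b b'} → MeetsOnce D C b b' → MeetsOnce D C b' b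
  MeetsOnce-sym (inj₁ (b∈C , b'∉C)) = inj₂ (b'∉C , b∈C)
  MeetsOnce-sym (inj₂ (b∉C , b'∈C)) = inj₁ (b'∈C , b∉C)

  both∈⇒¬MeetsOnce : ∀ {C b b'} → b ∈ C → b' ∈ C → ¬ MeetsOnce D C b b'
  both∈⇒¬MeetsOnce b∈C b'∈C (inj₁ (_ , b'∉C)) = b'∉C b'∈C
  both∈⇒¬MeetsOnce b∈C b'∈C (inj₂ (b∉C , _)) = b∉C b∈C

  PropertyP-sym : ∀ {b b'} → PropertyP D b b' → PropertyP D b' b
  PropertyP-sym P a a' ab' a'b = Adj-sym (P a' a a'b ab')

  Independent : Subset n → Set
  Independent I = ∀ {u v} → u ∈ I → v ∈ I → ¬ Arc D u v

  Dominated : Subset n → Fin n → Set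
  Dominated I v = ∃[ u ] (u ∈ I × Adj D v u)

  Dominated? : ∀ I v → Dec (Dominated I v)
  Dominated? I v = any? λ u → (u ∈? I) ×-dec Adj? v u

  Avoids : (Fin n → Set) → Subset n → Set
  Avoids F I = ∀ {v} → v ∈ I → ¬ F v

  Independent⇒¬Adj : ∀ {I u v} → Independent I → u ∈ I → v ∈ I → ¬ Adj D u v
  Independent⇒¬Adj ind u∈I v∈I (inj₁ uv) = ind u∈I v∈I uv
  Independent⇒¬Adj ind u∈I v∈I (inj₂ vu) = ind v∈I u∈I vu

  ⁅⁆-independent : ∀ v → Independent ⁅ v ⁆
  ⁅⁆-independent v u∈ w∈ rewrite x∈⁅y⁆⇒x≡y v u∈ | x∈⁅y⁆⇒x≡y v w∈ = no-loop v

  ∪⁅⁆-independent : ∀ {S v} → Independent S → ¬ Dominated S v → Independent (S ∪ ⁅ v ⁆)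
  ∪⁅⁆-independent {S} {v} ind ¬dom u∈ w∈ with x∈p∪q⁻ S ⁅ v ⁆ u∈ | x∈p∪q⁻ S ⁅ v ⁆ w∈
  ... | inj₁ u∈S | inj₁ w∈S = ind u∈S w∈S
  ... | inj₁ u∈S | inj₂ w∈v rewrite x∈⁅y⁆⇒x≡y v w∈v = λ uv → ¬dom (_ , u∈S , inj₂ uv)
  ... | inj₂ u∈v | inj₁ w∈S rewrite x∈⁅y⁆⇒x≡y v u∈v = λ vw → ¬dom (_ , w∈S , inj₁ vw)
  ... | inj₂ u∈v | inj₂ w∈v = ⁅⁆-independent v u∈v w∈v

  ⁅⁆-¬Dominated : ∀ {a a'} → ¬ Adj D a a' → ¬ Dominated ⁅ a ⁆ a'
  ⁅⁆-¬Dominated {a} ¬aa' (u , u∈a , a'u) rewrite x∈⁅y⁆⇒x≡y a u∈a = ¬aa' (Adj-sym a'u)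

  ⁅⁆-avoids : ∀ {F v} → ¬ F v → Avoids F ⁅ v ⁆
  ⁅⁆-avoids {v = v} ¬Fv u∈v rewrite x∈⁅y⁆⇒x≡y v u∈v = ¬Fv

  ∪⁅⁆-avoids : ∀ {F S v} → Avoids F S → ¬ F v → Avoids F (S ∪ ⁅ v ⁆)
  ∪⁅⁆-avoids {S = S} {v} avoids ¬Fv u∈ = [ avoids , ⁅⁆-avoids ¬Fv ] (x∈p∪q⁻ S ⁅ v ⁆ u∈)

  record MaximalOn (F : Fin n → Set) (S : Subset n) (vs : List (Fin n)) : Set where
    field
      I           : Subset n
      S⊆I         : S ⊆ I
      independent : Independent I
      avoids      : Avoids F I
      maximal     : All (λ v → v ∈ I ⊎ F v ⊎ Dominated I v) vs

  open MaximalOn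

  MaximalOn-∷ : ∀ {F S S' vs v} → S ⊆ S' → (E : MaximalOn F S' vs) →
                v ∈ I E ⊎ F v ⊎ Dominated (I E) v → MaximalOn F S (v ∷ vs)
  MaximalOn-∷ S⊆S' E v-maximal = record
    { I = I E
    ; S⊆I = S⊆I E ∘ S⊆S'
    ; independent = independent E
    ; avoids = avoids E
    ; maximal = v-maximal ∷ maximal E
    }

  extendMaximalOn : ∀ {F} → Decidable F → ∀ {S} vs →
                    Independent S → Avoids F S → MaximalOn F S vs
  extendMaximalOn F? [] ind avoids = record
    { I = _ ; S⊆I = id ; independent = ind ; avoids = avoids ; maximal = [] }
  extendMaximalOn F? {S} (v ∷ vs) ind avoids with F? v | Dominated? S v
  ... | yes Fv | _ = MaximalOn-∷ id E (inj₂ (inj₁ Fv))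
    where E = extendMaximalOn F? vs ind avoids
  ... | no _ | yes (u , u∈S , vu) = MaximalOn-∷ id E (inj₂ (inj₂ (u , S⊆I E u∈S , vu)))
    where E = extendMaximalOn F? vs ind avoids
  ... | no ¬Fv | no ¬dom = MaximalOn-∷ (p⊆p∪q ⁅ v ⁆) E (inj₁ (S⊆I E (q⊆p∪q S ⁅ v ⁆ (x∈⁅x⁆ v))))
    where E = extendMaximalOn F? vs (∪⁅⁆-independent ind ¬dom) (∪⁅⁆-avoids avoids ¬Fv)

  maximalIndependent : ∀ {F} → Decidable F → ∀ {S} → Independent S → Avoids F S →
                       MaximalOn F S (allFin n)
  maximalIndependent F? = extendMaximalOn F? (allFin n)

  ∉⇒forbidden⊎dominated : ∀ {F S} (E : MaximalOn F S (allFin n)) {v} →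
                          v ∉ I E → F v ⊎ Dominated (I E) v
  ∉⇒forbidden⊎dominated E {v} v∉I with All.lookup (maximal E) (∈-allFin v)
  ... | inj₁ v∈I = contradiction v∈I v∉I
  ... | inj₂ FvOrDom = FvOrDom

  Supported : Subset n → Fin n → Set
  Supported I v = ∃[ a ] (Arc D a v × a ∉ I × (∀ {z} → Arc D a z → z ∉ I) × InV⁺ D a)

  ∁-isStrongVertexCover : ∀ {I} → Independent I →
                          (∀ {v} → v ∉ I → Dominated I v ⊎ Supported I v) →
                          IsStrongVertexCover D (∁ I)
  ∁-isStrongVertexCover {I} ind dominatedOrSupported = cover , strong
    where
    cover : IsVertexCover D (∁ I)
    cover x y xy with x ∈? I | y ∈? I
    ... | yes x∈I | yes y∈I = contradiction xy (ind x∈I y∈I)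
    ... | yes _   | no y∉I  = inj₂ (x∉p⇒x∈∁p y∉I)
    ... | no x∉I  | _       = inj₁ (x∉p⇒x∈∁p x∉I)

    strong : ∀ x → InL₃ D (∁ I) x →
             ∃[ y ] (Arc D y x × y ∈ ∁ I × ¬ InL₁ D (∁ I) y × InV⁺ D y)
    strong x (x∈C , ¬L₁ , ¬L₂) with dominatedOrSupported (x∈∁p⇒x∉p x∈C)
    ... | inj₁ (u , u∈I , inj₁ xu) =
      contradiction (x∈C , u , xu , λ u∈C → x∈∁p⇒x∉p u∈C u∈I) ¬L₁
    ... | inj₁ (u , u∈I , inj₂ ux) =
      contradiction (x∈C , ¬L₁ , u , ux , λ u∈C → x∈∁p⇒x∉p u∈C u∈I) ¬L₂
    ... | inj₂ (a , ax , a∉I , N⁺a∩I=∅ , a∈V⁺) =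
      a , ax , x∉p⇒x∈∁p a∉I , (λ (_ , z , az , z∉C) → N⁺a∩I=∅ az (x∉∁p⇒x∈p z∉C)) , a∈V⁺

  ∁-¬MeetsOnce : ∀ {I b b'} → b ∉ I → b' ∉ I → ¬ MeetsOnce D (∁ I) b b'
  ∁-¬MeetsOnce b∉I b'∉I = both∈⇒¬MeetsOnce (x∉p⇒x∈∁p b∉I) (x∉p⇒x∈∁p b'∉I)

  StrongCoversMeetOnce : Fin n → Fin n → Set
  StrongCoversMeetOnce b b' = ∀ C → IsStrongVertexCover D C → MeetsOnce D C b b'

  StrongCoversMeetOnce-sym : ∀ {b b'} → StrongCoversMeetOnce b b' → StrongCoversMeetOnce b' b
  StrongCoversMeetOnce-sym meets C strong = MeetsOnce-sym (meets C strong)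

  StrongCoversMeetOnce⇒PropertyP : ∀ {b b'} → StrongCoversMeetOnce b b' → PropertyP D b b'
  StrongCoversMeetOnce⇒PropertyP {b} {b'} meets a a' ab a'b' with Adj? a a'
  ... | yes aa' = aa'
  ... | no ¬aa' =
    ⊥-elim (∁-¬MeetsOnce b∉I b'∉I (meets _ (∁-isStrongVertexCover (independent E) dominated)))
    where
    E = maximalIndependent {F = λ _ → ⊥} (λ _ → no id)
          (∪⁅⁆-independent (⁅⁆-independent a) (⁅⁆-¬Dominated ¬aa')) (λ _ ())
    dominated : ∀ {v} → v ∉ I E → Dominated (I E) v ⊎ Supported (I E) v
    dominated v∉I = [ ⊥-elim , inj₁ ] (∉⇒forbidden⊎dominated E v∉I)
    a∈I : a ∈ I E
    a∈I = S⊆I E (p⊆p∪q ⁅ a' ⁆ (x∈⁅x⁆ a))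
    a'∈I : a' ∈ I E
    a'∈I = S⊆I E (q⊆p∪q ⁅ a ⁆ ⁅ a' ⁆ (x∈⁅x⁆ a'))
    b∉I : b ∉ I E
    b∉I b∈I = Independent⇒¬Adj (independent E) a∈I b∈I ab
    b'∉I : b' ∉ I E
    b'∉I b'∈I = Independent⇒¬Adj (independent E) a'∈I b'∈I a'b'

  StrongCoversMeetOnce⇒NbhdCond : ∀ {b b'} → StrongCoversMeetOnce b b' → PropertyP D b b' →
                                   NbhdCond D b b'
  StrongCoversMeetOnce⇒NbhdCond {b} {b'} meets P a ab' a∈V⁺ x bx with T? (arc a x)
  ... | yes ax = ax
  ... | no ¬ax with P x a (Adj-sym bx) (inj₁ ab')
  ...   | inj₂ ax = contradiction ax ¬ax
  ...   | inj₁ xa = ⊥-elim (∁-¬MeetsOnce b∉I b'∉I (meets _ strongCover))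
    where
    E = maximalIndependent {F = Arc D a} (λ v → T? (arc a v))
          (⁅⁆-independent x) (⁅⁆-avoids ¬ax)
    x∈I : x ∈ I E
    x∈I = S⊆I E (x∈⁅x⁆ x)
    a∉I : a ∉ I E
    a∉I a∈I = independent E x∈I a∈I xa
    dominatedOrSupported : ∀ {v} → v ∉ I E → Dominated (I E) v ⊎ Supported (I E) v
    dominatedOrSupported v∉I with ∉⇒forbidden⊎dominated E v∉I
    ... | inj₁ av = inj₂ (a , av , a∉I , (λ az z∈I → avoids E z∈I az) , a∈V⁺)
    ... | inj₂ dominated = inj₁ dominated
    b∉I : b ∉ I E
    b∉I b∈I = Independent⇒¬Adj (independent E) b∈I x∈I bx
    b'∉I : b' ∉ I E
    b'∉I b'∈I = avoids E b'∈I ab'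
    strongCover : IsStrongVertexCover D (∁ (I E))
    strongCover = ∁-isStrongVertexCover (independent E) dominatedOrSupported

  HasOuterNeighbour : Subset n → Fin n → Set
  HasOuterNeighbour C v = ∃[ y ] (Adj D v y × y ∉ C)

  ¬HasOuterNeighbour⇒InL₃ : ∀ {C v} → v ∈ C → ¬ HasOuterNeighbour C v → InL₃ D C v
  ¬HasOuterNeighbour⇒InL₃ v∈C ¬outer =
    v∈C , (λ (_ , y , vy , y∉C) → ¬outer (y , inj₁ vy , y∉C))
        , (λ (_ , _ , y , yv , y∉C) → ¬outer (y , inj₂ yv , y∉C))

  IsStrongVertexCover⇒HasOuterNeighbour :
    ∀ {C b b'} → IsStrongVertexCover D C → NbhdCond D b b' → NbhdCond D b' b →
    b ∈ C → b' ∈ C → HasOuterNeighbour C b'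
  IsStrongVertexCover⇒HasOuterNeighbour {C} {b} {b'} (_ , strong) N N' b∈C b'∈C
    with any? (λ y → Adj? b' y ×-dec ¬? (y ∈? C))
  ... | yes outer = outer
  ... | no ¬outer with strong b' (¬HasOuterNeighbour⇒InL₃ b'∈C ¬outer)
  ... | a , ab' , a∈C , a∉L₁ , a∈V⁺ =
    let ¬outerᵇ : ¬ HasOuterNeighbour C b
        ¬outerᵇ = λ (y , by , y∉C) → a∉L₁ (a∈C , y , N a ab' a∈V⁺ y by , y∉C)
        (a' , a'b , _ , _ , a'∈V⁺) = strong b (¬HasOuterNeighbour⇒InL₃ b∈C ¬outerᵇ)
    in ⊥-elim (oriented a a' (N a ab' a∈V⁺ a' (inj₂ a'b)) (N' a' a'b a'∈V⁺ a (inj₂ ab')))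

  PropertyP×NbhdCond⇒StrongCoversMeetOnce :
    ∀ {b b'} → Adj D b b' → PropertyP D b b' → NbhdCond D b b' → NbhdCond D b' b →
    StrongCoversMeetOnce b b'
  PropertyP×NbhdCond⇒StrongCoversMeetOnce {b} {b'} bb' P N N' C strongCover@(cover , _)
    with b ∈? C | b' ∈? C
  ... | yes b∈C | no b'∉C = inj₁ (b∈C , b'∉C)
  ... | no b∉C  | yes b'∈C = inj₂ (b∉C , b'∈C)
  ... | no b∉C  | no b'∉C = ⊥-elim ([ b∉C , b'∉C ] (IsVertexCover-Adj cover bb'))
  ... | yes b∈C | yes b'∈C
    with IsStrongVertexCover⇒HasOuterNeighbour strongCover N' N b'∈C b∈C
       | IsStrongVertexCover⇒HasOuterNeighbour strongCover N N' b∈C b'∈C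
  ... | y , by , y∉C | y' , b'y' , y'∉C =
    ⊥-elim ([ y∉C , y'∉C ] (IsVertexCover-Adj cover (P y y' (Adj-sym by) (Adj-sym b'y'))))

proposition4p1 : ∀ {n} (D : WOG n) (b b' : Fin n) → Adj D b b' →
    ((∀ C → IsStrongVertexCover D C → MeetsOnce D C b b')
    ⇔ (PropertyP D b b' × NbhdCond D b b' × NbhdCond D b' b))
proposition4p1 D b b' bb' = mk⇔ forward backward
  where
  forward : StrongCoversMeetOnce D b b' → PropertyP D b b' × NbhdCond D b b' × NbhdCond D b' b
  forward meets =
    P , StrongCoversMeetOnce⇒NbhdCond D meets P
      , StrongCoversMeetOnce⇒NbhdCond D (StrongCoversMeetOnce-sym D meets) (PropertyP-sym D P)
    where P = StrongCoversMeetOnce⇒PropertyP D meets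

  backward : PropertyP D b b' × NbhdCond D b b' × NbhdCond D b' b → StrongCoversMeetOnce D b b'
  backward (P , N , N') = PropertyP×NbhdCond⇒StrongCoversMeetOnce D bb' P N N'
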